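{- Let $S$ be a maximal simplex of $\mathcal{P}$. Then \[\text{vol}(S)=\frac{\sqrt{n}}{(n+r-1)!},\] where $n$ is the number of edges and $n+r-1$ is the dimension of $\mathcal{P}$. In particular, all the maximal simplices of $\mathcal{P}$ have the same volume.
   Context: Let $\mathcal{M}$ be a loopless regular matroid with $n$ edges represented by an $r\times n$ totally unimodular matrix $M$ of rank $r>0$. The Lawrence polytope $\mathcal{P}\subseteq\mathbb{R}^{n+r}$ is the convex hull of the columns of $\begin{pmatrix} M & \mathbf{0} \\ I_{n\times n} & I_{n\times n}\end{pmatrix}$, with $I_{n\times n}$ the $n\times n$ identity matrix; it lies in the affine hyperplane $\sum_{i=1}^n y_i=1$ (coordinates $(x_1,\dots,x_r,y_1,\dots,y_n)$) and has dimension $n+r-1$. A maximal simplex of $\mathcal{P}$ is an $(n+r-1)$-dimensional simplex spanned by $n+r$ vertices of $\mathcal{P}$, and vol denotes $(n+r-1)$-dimensional Euclidean volume. -}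

module Defs where

open import Data.Nat as ℕ using (ℕ; zero; suc; _∸_; _!)
open import Data.Nat.Properties using (_!*_!≢0)
open import Data.Integer as ℤ using (ℤ; +_; -_)
open import Data.Rational as ℚ using (ℚ)
open import Data.Fin using (Fin; zero; suc; punchIn)
open import Data.Sum using (_⊎_; inj₁; inj₂)
open import Data.Product using (Σ; ∃; _×_; _,_)
open import Data.Empty using (⊥)
open import Relation.Nullary using (¬_)
open import Relation.Binary.PropositionalEquality using (_≡_; _≢_)
open import Function.Definitions using (Injective)

∑ : ∀ {k} → (Fin k → ℤ) → ℤ
∑ {zero}  f = + 0
∑ {suc k} f = f zero ℤ.+ ∑ (λ i → f (suc i))

Mat : ℕ → ℕ → Set
Mat a b = Fin a → Fin b → ℤ

sgn : ∀ {k} → Fin k → ℤ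
sgn zero    = + 1
sgn (suc j) = - sgn j

det : ∀ {k} → Mat k k → ℤ
det {zero}  A = + 1
det {suc k} A = ∑ (λ j → sgn j ℤ.* (A zero j ℤ.* det (λ i l → A (suc i) (punchIn j l))))

-- Totally unimodular: every square submatrix has determinant in {-1,0,1}.
-- (Row/column selections are arbitrary maps; non-injective ones give
-- repeated rows/columns and hence determinant 0.)
TotallyUnimodular : ∀ {r n} → Mat r n → Set
TotallyUnimodular {r} {n} M =
  ∀ k (f : Fin k → Fin r) (g : Fin k → Fin n) →
  let d = det (λ i j → M (f i) (g j)) in
  (d ≡ - (+ 1)) ⊎ (d ≡ + 0) ⊎ (d ≡ + 1)

-- Rank r (for an r × n matrix): full row rank, i.e. some r × r minor is nonzero
-- (determinantal rank).
HasRank : ∀ {r n} → Mat r n → ℕ → Set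
HasRank {r} {n} M ρ = ρ ≡ r × ∃ λ (g : Fin r → Fin n) → det (λ i j → M i (g j)) ≢ + 0

Loopless : ∀ {r n} → Mat r n → Set
Loopless {r} {n} M = ∀ (e : Fin n) → ∃ λ (i : Fin r) → M i e ≢ + 0

Coord : ℕ → ℕ → Set
Coord r n = Fin r ⊎ Fin n

-- The 2n columns of ( M 0 ; I I ): inj₁ e = (M_e, e_e), inj₂ e = (0, e_e)
VertexIx : ℕ → Set
VertexIx n = Fin n ⊎ Fin n

δ : ∀ {n} → Fin n → Fin n → ℤ
δ zero    zero    = + 1
δ zero    (suc _) = + 0
δ (suc _) zero    = + 0
δ (suc a) (suc b) = δ a b

lawrenceVertex : ∀ {r n} → Mat r n → VertexIx n → Coord r n → ℤ
lawrenceVertex M (inj₁ e) (inj₁ i) = M i e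
lawrenceVertex M (inj₁ e) (inj₂ j) = δ e j
lawrenceVertex M (inj₂ e) (inj₁ i) = + 0
lawrenceVertex M (inj₂ e) (inj₂ j) = δ e j

∑Coord : ∀ {r n} → (Coord r n → ℤ) → ℤ
∑Coord f = ∑ (λ i → f (inj₁ i)) ℤ.+ ∑ (λ j → f (inj₂ j))

dimP : ℕ → ℕ → ℕ
dimP n r = n ℕ.+ r ∸ 1

-- A choice of vertices of 𝒫 (a list of m vertices)
-- affinely independent: the only (integer, equivalently rational/real)
-- affine dependence Σ λ_i v_i = 0 with Σ λ_i = 0 is trivial.
AffinelyIndependent : ∀ {r n m} → Mat r n → (Fin m → VertexIx n) → Set
AffinelyIndependent {r} {n} {m} M σ =
  ∀ (λ' : Fin m → ℤ) → ∑ λ' ≡ + 0 →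
  (∀ (c : Coord r n) → ∑ (λ i → λ' i ℤ.* lawrenceVertex M (σ i) c) ≡ + 0) →
  ∀ i → λ' i ≡ + 0

IsMaximalSimplex : ∀ {r n} → Mat r n → (Fin (suc (dimP n r)) → VertexIx n) → Set
IsMaximalSimplex M σ = Injective _≡_ _≡_ σ × AffinelyIndependent M σ

edgeVec : ∀ {r n d} → Mat r n → (Fin (suc d) → VertexIx n) → Fin d → Coord r n → ℤ
edgeVec M σ i c = lawrenceVertex M (σ (suc i)) c ℤ.- lawrenceVertex M (σ zero) c

gram : ∀ {r n d} → Mat r n → (Fin (suc d) → VertexIx n) → Mat d d
gram M σ i j = ∑Coord (λ c → edgeVec M σ i c ℤ.* edgeVec M σ j c)

-- Squared d-dimensional Euclidean volume of the simplex conv(v_σ(0),…,v_σ(d)):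
-- vol² = det(Gram(w_1,…,w_d)) / (d!)²
volSq : ∀ {r n d} → Mat r n → (Fin (suc d) → VertexIx n) → ℚ
volSq {d = d} M σ = ℚ._/_ (det (gram M σ)) (d ! ℕ.* d !) {{d !* d !≢0}}

{-# OPTIONS --safe #-}
module Submission where

-- List the n + r coordinates as Fin (r + n) and let V be the square matrix whose columns
-- are the vertices v₀, …, v_d of S. V is a square submatrix of the Lawrence matrix
-- (M 0 ; I I), which is totally unimodular along with M, and V is nonsingular because the
-- vertices are affinely independent; hence det V = ±1. Let ν be the indicator of the
-- y-coordinates (the normal of the hyperplane Σ y = 1) and A = [ν | w₁ … w_d] with the edge
-- vectors wᵢ = vᵢ − v₀. Since ν·ν = n and ν·wᵢ = 0, AᵀA is block diagonal with blocks n and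
-- Gram(w), so n · det Gram = (det A)². The row vector νᵀ annihilates [n v₀ − ν | w], so by
-- linearity in the first column det A = n · det [v₀ | w] = n · det V. Therefore
-- n · det Gram = n², i.e. det Gram = n and vol² = n / (d!)².

open import Defs
open import Data.Empty using (⊥-elim)
open import Data.Fin using (Fin; zero; suc; punchIn; punchOut; lift; _↑ˡ_; _↑ʳ_; splitAt; join)
open import Data.Fin.Permutation.Components using (transpose; transpose-inverse)
open import Data.Fin.Properties
  using (_≟_; any?; pigeonhole; <⇒≢; nonZeroIndex; punchInᵢ≢i; punchIn-punchOut; punchOut-injective;
         splitAt-↑ˡ; splitAt-↑ʳ; splitAt-join)
open import Data.Integer as ℤ using (ℤ; +_; -_; -[1+_]; _+_; _*_; _-_; ∣_∣)
open import Data.Integer.Properties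
  using (+-identityˡ; +-identityʳ; +-assoc; *-identityˡ; *-identityʳ; *-zeroˡ; *-zeroʳ; *-assoc; *-comm;
         *-distribˡ-+; *-distribʳ-+; neg-distrib-+; neg-involutive; neg-distribˡ-*; neg-distribʳ-*;
         ∣-i∣≡∣i∣; ∣i∣≡0⇒i≡0; i*j≡0⇒i≡0∨j≡0; i-j≡0⇒i≡j; *-cancelˡ-≡; +-0-abelianGroup)
  renaming (_≟_ to _≟ℤ_)
open import Algebra.Properties.AbelianGroup +-0-abelianGroup using (inverseʳ-unique)
open import Data.Integer.Tactic.RingSolver using (solve-∀)
open import Data.Nat as ℕ using (ℕ; zero; suc; _<_; _!; s≤s; z≤n)
open import Data.Nat.Properties using (_!*_!≢0; n<1+n; +-suc) renaming (+-comm to ℕ+-comm)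
open import Data.Product using (Σ; ∃; ∃₂; _×_; _,_; proj₁; proj₂)
open import Data.Rational using (_/_)
open import Data.Sum using (_⊎_; inj₁; inj₂; [_,_]′)
open import Data.Sum.Properties using (≡-dec)
open import Data.Vec.Functional using (updateAt; insertAt; _∷_; [])
open import Data.Vec.Functional.Properties
  using (updateAt-updates; updateAt-minimal; updateAt-commutes; map-updateAt; insertAt-lookup; insertAt-punchIn)
open import Function using (_∘_; const; id)
open import Relation.Binary.PropositionalEquality
open import Relation.Nullary using (¬_; ¬?; Dec; yes; no; _×-dec_)
open import Relation.Nullary.Decidable using (dec-true; dec-false; decidable-stable)

x≡-x⇒x≡0 : ∀ {x} → x ≡ - x → x ≡ + 0
x≡-x⇒x≡0 {+ zero}   _ = refl
x≡-x⇒x≡0 {+ suc n}  ()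
x≡-x⇒x≡0 { -[1+ n ]} ()

i≢0∧i*j≡0⇒j≡0 : ∀ {i j} → i ≢ + 0 → i * j ≡ + 0 → j ≡ + 0
i≢0∧i*j≡0⇒j≡0 {i} i≢0 ij≡0 = [ (λ i≡0 → ⊥-elim (i≢0 i≡0)) , id ]′ (i*j≡0⇒i≡0∨j≡0 i ij≡0)

∣x∣≤1∧x≢0⇒x*x≡1 : ∀ {x} → ∣ x ∣ ℕ.≤ 1 → x ≢ + 0 → x * x ≡ + 1
∣x∣≤1∧x≢0⇒x*x≡1 {+ zero}             _               x≢0 = ⊥-elim (x≢0 refl)
∣x∣≤1∧x≢0⇒x*x≡1 {+ suc zero}         _               _   = refl
∣x∣≤1∧x≢0⇒x*x≡1 {+ suc (suc _)}      (s≤s ())        _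
∣x∣≤1∧x≢0⇒x*x≡1 { -[1+ zero ]}       _               _   = refl
∣x∣≤1∧x≢0⇒x*x≡1 { -[1+ suc _ ]}      (s≤s ())        _

i≡0⇒∣i∣≤1 : ∀ {i} → i ≡ + 0 → ∣ i ∣ ℕ.≤ 1
i≡0⇒∣i∣≤1 refl = z≤n

∑-cong : ∀ {k} {f g : Fin k → ℤ} → (∀ i → f i ≡ g i) → ∑ f ≡ ∑ g
∑-cong {zero}  f≗g = refl
∑-cong {suc k} f≗g = cong₂ _+_ (f≗g zero) (∑-cong (f≗g ∘ suc))

∑-zero : ∀ {k} {f : Fin k → ℤ} → (∀ i → f i ≡ + 0) → ∑ f ≡ + 0
∑-zero {zero}  f≗0 = refl
∑-zero {suc k} f≗0 = cong₂ _+_ (f≗0 zero) (∑-zero (f≗0 ∘ suc))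

∑-distrib-+ : ∀ {k} (f g : Fin k → ℤ) → ∑ (λ i → f i + g i) ≡ ∑ f + ∑ g
∑-distrib-+ {zero}  f g = refl
∑-distrib-+ {suc k} f g =
  trans (cong (_+_ (f zero + g zero)) (∑-distrib-+ (f ∘ suc) (g ∘ suc)))
        (swap-middle (f zero) (g zero) (∑ (f ∘ suc)) (∑ (g ∘ suc)))
  where
  swap-middle : ∀ a b c d → a + b + (c + d) ≡ a + c + (b + d)
  swap-middle = solve-∀

∑-distrib-neg : ∀ {k} (f : Fin k → ℤ) → ∑ (λ i → - f i) ≡ - ∑ f
∑-distrib-neg {zero}  f = refl
∑-distrib-neg {suc k} f = trans (cong (_+_ (- f zero)) (∑-distrib-neg (f ∘ suc))) (sym (neg-distrib-+ (f zero) (∑ (f ∘ suc))))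

∑-distrib-- : ∀ {k} (f g : Fin k → ℤ) → ∑ (λ i → f i - g i) ≡ ∑ f - ∑ g
∑-distrib-- f g = trans (∑-distrib-+ f (λ i → - g i)) (cong (_+_ (∑ f)) (∑-distrib-neg g))

*-distribˡ-∑ : ∀ {k} (c : ℤ) (f : Fin k → ℤ) → c * ∑ f ≡ ∑ (λ i → c * f i)
*-distribˡ-∑ {zero}  c f = *-zeroʳ c
*-distribˡ-∑ {suc k} c f = trans (*-distribˡ-+ c (f zero) (∑ (f ∘ suc))) (cong (_+_ (c * f zero)) (*-distribˡ-∑ c (f ∘ suc)))

*-distribʳ-∑ : ∀ {k} (c : ℤ) (f : Fin k → ℤ) → ∑ f * c ≡ ∑ (λ i → f i * c)
*-distribʳ-∑ {zero}  c f = *-zeroˡ c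
*-distribʳ-∑ {suc k} c f = trans (*-distribʳ-+ c (f zero) (∑ (f ∘ suc))) (cong (_+_ (f zero * c)) (*-distribʳ-∑ c (f ∘ suc)))

∑-comm : ∀ {k m} (f : Fin k → Fin m → ℤ) → ∑ (λ i → ∑ (f i)) ≡ ∑ (λ j → ∑ (λ i → f i j))
∑-comm {zero}  {m} f = sym (∑-zero {m} (λ _ → refl))
∑-comm {suc k} f =
  trans (cong (_+_ (∑ (f zero))) (∑-comm (f ∘ suc))) (sym (∑-distrib-+ (f zero) (λ j → ∑ (λ i → f (suc i) j))))

∑-comm-* : ∀ {k m} (a : Fin k → ℤ) (c : Fin m → ℤ) (F : Fin k → Fin m → ℤ) →
           ∑ (λ j → a j * ∑ (λ t → c t * F j t)) ≡ ∑ (λ t → c t * ∑ (λ j → a j * F j t))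
∑-comm-* a c F = begin
  ∑ (λ j → a j * ∑ (λ t → c t * F j t))
    ≡⟨ ∑-cong (λ j → trans (*-distribˡ-∑ (a j) (λ t → c t * F j t)) (∑-cong (λ t → exchange (a j) (c t) (F j t)))) ⟩
  ∑ (λ j → ∑ (λ t → c t * (a j * F j t)))
    ≡⟨ ∑-comm (λ j t → c t * (a j * F j t)) ⟩
  ∑ (λ t → ∑ (λ j → c t * (a j * F j t)))
    ≡⟨ ∑-cong (λ t → sym (*-distribˡ-∑ (c t) (λ j → a j * F j t))) ⟩
  ∑ (λ t → c t * ∑ (λ j → a j * F j t)) ∎
  where
  open ≡-Reasoning
  exchange : ∀ x y z → x * (y * z) ≡ y * (x * z)
  exchange = solve-∀

∑-remove : ∀ {k} (f : Fin (suc k) → ℤ) (j : Fin (suc k)) → ∑ f ≡ f j + ∑ (f ∘ punchIn j)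
∑-remove {k}     f zero    = refl
∑-remove {suc k} f (suc j) =
  trans (cong (_+_ (f zero)) (∑-remove (f ∘ suc) j)) (exchange (f zero) (f (suc j)) (∑ (f ∘ suc ∘ punchIn j)))
  where
  exchange : ∀ a b c → a + (b + c) ≡ b + (a + c)
  exchange = solve-∀

∑-single : ∀ {k} (f : Fin k → ℤ) (j : Fin k) → (∀ i → i ≢ j → f i ≡ + 0) → ∑ f ≡ f j
∑-single {suc k} f j f≡0 = begin
  ∑ f                        ≡⟨ ∑-remove f j ⟩
  f j + ∑ (f ∘ punchIn j)    ≡⟨ cong (_+_ (f j)) (∑-zero (λ i → f≡0 (punchIn j i) (punchInᵢ≢i j i))) ⟩
  f j + + 0                  ≡⟨ +-identityʳ (f j) ⟩
  f j                        ∎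
  where open ≡-Reasoning

∑-split : ∀ m n (f : Fin (m ℕ.+ n) → ℤ) → ∑ f ≡ ∑ (λ i → f (i ↑ˡ n)) + ∑ (λ j → f (m ↑ʳ j))
∑-split zero    n f = sym (+-identityˡ (∑ f))
∑-split (suc m) n f = trans (cong (_+_ (f zero)) (∑-split m n (f ∘ suc)))
                            (sym (+-assoc (f zero) (∑ (λ i → f (suc (i ↑ˡ n)))) (∑ (λ j → f (suc (m ↑ʳ j))))))

∑-one : ∀ k → ∑ {k} (λ _ → + 1) ≡ + k
∑-one zero    = refl
∑-one (suc k) = cong (_+_ (+ 1)) (∑-one k)

∑-insertAt : ∀ {k} (x : Fin (suc k) → ℤ) (y : Fin k → ℤ) (j : Fin (suc k)) (c : ℤ) →
             ∑ (λ l → x l * insertAt y j c l) ≡ x j * c + ∑ (λ b → x (punchIn j b) * y b)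
∑-insertAt x y j c = trans (∑-remove (λ l → x l * insertAt y j c l) j)
  (cong₂ _+_ (cong (x j *_) (insertAt-lookup y j c)) (∑-cong (λ b → cong (x (punchIn j b) *_) (insertAt-punchIn y j c b))))

δ-refl : ∀ {k} (i : Fin k) → δ i i ≡ + 1
δ-refl zero    = refl
δ-refl (suc i) = δ-refl i

δ-≢ : ∀ {k} {i j : Fin k} → i ≢ j → δ i j ≡ + 0
δ-≢ {i = zero}  {zero}  i≢j = ⊥-elim (i≢j refl)
δ-≢ {i = zero}  {suc j} i≢j = refl
δ-≢ {i = suc i} {zero}  i≢j = refl
δ-≢ {i = suc i} {suc j} i≢j = δ-≢ (i≢j ∘ cong suc)

∑-δ : ∀ {k} (i : Fin k) → ∑ (δ i) ≡ + 1
∑-δ i = trans (∑-single (δ i) i (λ j j≢i → δ-≢ (j≢i ∘ sym))) (δ-refl i)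

∑-*-δ : ∀ {k} (f : Fin k → ℤ) (j : Fin k) → ∑ (λ t → f t * δ t j) ≡ f j
∑-*-δ f j = begin
  ∑ (λ t → f t * δ t j)  ≡⟨ ∑-single _ j (λ t t≢j → trans (cong (f t *_) (δ-≢ t≢j)) (*-zeroʳ (f t))) ⟩
  f j * δ j j            ≡⟨ cong (f j *_) (δ-refl j) ⟩
  f j * + 1              ≡⟨ *-identityʳ (f j) ⟩
  f j                    ∎
  where open ≡-Reasoning

sgn≢0 : ∀ {k} (j : Fin k) → sgn j ≢ + 0
sgn≢0 zero    ()
sgn≢0 (suc j) sgn≡0 = sgn≢0 j (trans (sym (neg-involutive (sgn j))) (cong -_ sgn≡0))

∣sgn*∣ : ∀ {k} (j : Fin k) (x : ℤ) → ∣ sgn j * x ∣ ≡ ∣ x ∣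
∣sgn*∣ zero    x = cong ∣_∣ (*-identityˡ x)
∣sgn*∣ (suc j) x = trans (cong ∣_∣ (sym (neg-distribˡ-* (sgn j) x))) (trans (∣-i∣≡∣i∣ (sgn j * x)) (∣sgn*∣ j x))

transpose-matchˡ : ∀ {k} (p q : Fin k) → transpose p q p ≡ q
transpose-matchˡ p q rewrite dec-true (p ≟ p) refl = refl

transpose-matchʳ : ∀ {k} (p q : Fin k) → transpose p q q ≡ p
transpose-matchʳ p q with q ≟ p
... | yes refl = refl
... | no _ rewrite dec-true (q ≟ q) refl = refl

transpose-other : ∀ {k} {p q i : Fin k} → i ≢ p → i ≢ q → transpose p q i ≡ i
transpose-other {p = p} {q} {i} i≢p i≢q rewrite dec-false (i ≟ p) i≢p | dec-false (i ≟ q) i≢q = refl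

transpose-same : ∀ {k} (p i : Fin k) → transpose p p i ≡ i
transpose-same p i = by-cases (i ≟ p)
  where
  by-cases : Dec (i ≡ p) → transpose p p i ≡ i
  by-cases (yes refl) = transpose-matchˡ i i
  by-cases (no i≢p)   = transpose-other i≢p i≢p

swap₀₁ : ∀ {k} → Fin (suc (suc k)) → Fin (suc (suc k))
swap₀₁ = transpose zero (suc zero)

swap₀₁-suc : ∀ {k} (l : Fin (suc k)) → swap₀₁ (suc l) ≡ punchIn (suc zero) l
swap₀₁-suc zero    = refl
swap₀₁-suc (suc l) = refl

swap₀₁-punchIn₁ : ∀ {k} (l : Fin (suc k)) → swap₀₁ (punchIn (suc zero) l) ≡ suc l
swap₀₁-punchIn₁ zero    = refl
swap₀₁-punchIn₁ (suc l) = refl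

swap₀₁-punchIn₂₊ : ∀ {k} (j : Fin (suc k)) (l : Fin (suc (suc k))) →
                   swap₀₁ (punchIn (suc (suc j)) l) ≡ punchIn (suc (suc j)) (swap₀₁ l)
swap₀₁-punchIn₂₊ j zero          = refl
swap₀₁-punchIn₂₊ j (suc zero)    = refl
swap₀₁-punchIn₂₊ j (suc (suc l)) = refl

det-cong : ∀ {k} {A B : Mat k k} → (∀ i j → A i j ≡ B i j) → det A ≡ det B
det-cong {zero}  A≡B = refl
det-cong {suc k} A≡B =
  ∑-cong (λ j → cong₂ (λ x y → sgn j * (x * y)) (A≡B zero j) (det-cong (λ i l → A≡B (suc i) (punchIn j l))))

minor : ∀ {k} → Mat (suc k) (suc k) → Fin (suc k) → Fin (suc k) → Mat k k
minor A a b x y = A (punchIn a x) (punchIn b y)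

infix 10 _ᵀ

_ᵀ : ∀ {k m} → Mat k m → Mat m k
(A ᵀ) i j = A j i

det-col₀-expand : ∀ {k} (A : Mat (suc k) (suc k)) → det A ≡ ∑ (λ i → sgn i * (A i zero * det (minor A i zero)))
det-col₀-expand {zero}  A = refl
det-col₀-expand {suc k} A = cong (_+_ (+ 1 * (A zero zero * det (minor A zero zero)))) (begin
  ∑ (λ j → sgn (suc j) * (A zero (suc j) * det (minor A zero (suc j))))
    ≡⟨ ∑-cong (λ j → cong (λ x → sgn (suc j) * (A zero (suc j) * x)) (det-col₀-expand (minor A zero (suc j)))) ⟩
  ∑ (λ j → sgn (suc j) * (A zero (suc j) * ∑ (λ i → sgn i * (A (suc i) zero * D i j))))
    ≡⟨ ∑-cong (λ j → trans (assoc (sgn (suc j)) (A zero (suc j)) _)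
                           (cong (a j *_) (∑-cong (λ i → assoc (sgn i) (A (suc i) zero) (D i j))))) ⟩
  ∑ (λ j → a j * ∑ (λ i → c i * D i j))
    ≡⟨ ∑-comm-* a c (λ j i → D i j) ⟩
  ∑ (λ i → c i * ∑ (λ j → a j * D i j))
    ≡⟨ ∑-cong rescale ⟩
  ∑ (λ i → sgn (suc i) * (A (suc i) zero * det (minor A (suc i) zero))) ∎)
  where
  open ≡-Reasoning
  D : Fin (suc k) → Fin (suc k) → ℤ
  D i j = det (minor (minor A zero zero) i j)
  a c : Fin (suc k) → ℤ
  a j = sgn (suc j) * A zero (suc j)
  c i = sgn i * A (suc i) zero
  assoc : ∀ x y z → x * (y * z) ≡ x * y * z
  assoc = solve-∀
  move-sign : ∀ s x t y d → s * x * (- t * y * d) ≡ - s * (x * (t * (y * d)))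
  move-sign = solve-∀
  rescale : ∀ i → c i * ∑ (λ j → a j * D i j) ≡ sgn (suc i) * (A (suc i) zero * det (minor A (suc i) zero))
  rescale i = begin
    c i * ∑ (λ j → a j * D i j)
      ≡⟨ *-distribˡ-∑ (c i) (λ j → a j * D i j) ⟩
    ∑ (λ j → c i * (a j * D i j))
      ≡⟨ ∑-cong (λ j → move-sign (sgn i) (A (suc i) zero) (sgn j) (A zero (suc j)) (D i j)) ⟩
    ∑ (λ j → - sgn i * (A (suc i) zero * (sgn j * (A zero (suc j) * D i j))))
      ≡⟨ sym (*-distribˡ-∑ (- sgn i) (λ j → A (suc i) zero * (sgn j * (A zero (suc j) * D i j)))) ⟩
    - sgn i * ∑ (λ j → A (suc i) zero * (sgn j * (A zero (suc j) * D i j)))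
      ≡⟨ cong (- sgn i *_) (sym (*-distribˡ-∑ (A (suc i) zero) (λ j → sgn j * (A zero (suc j) * D i j)))) ⟩
    - sgn i * (A (suc i) zero * det (minor A (suc i) zero)) ∎

det-ᵀ : ∀ {k} (A : Mat k k) → det (A ᵀ) ≡ det A
det-ᵀ {zero}  A = refl
det-ᵀ {suc k} A =
  trans (∑-cong (λ j → cong (λ x → sgn j * (A j zero * x)) (det-ᵀ (minor A j zero)))) (sym (det-col₀-expand A))

det-row₀-sparse : ∀ {k} (A : Mat (suc k) (suc k)) (q : Fin (suc k)) → (∀ j → j ≢ q → A zero j ≡ + 0) →
                  det A ≡ sgn q * (A zero q * det (minor A zero q))
det-row₀-sparse A q A₀≡0 = ∑-single _ q (λ j j≢q →
  trans (cong (λ x → sgn j * (x * det (minor A zero j))) (A₀≡0 j j≢q))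
        (trans (cong (sgn j *_) (*-zeroˡ (det (minor A zero j)))) (*-zeroʳ (sgn j))))

det-col₀-sparse : ∀ {k} (A : Mat (suc k) (suc k)) (p : Fin (suc k)) → (∀ i → i ≢ p → A i zero ≡ + 0) →
                  det A ≡ sgn p * (A p zero * det (minor A p zero))
det-col₀-sparse A p A₀≡0 = trans (det-col₀-expand A) (∑-single _ p (λ i i≢p →
  trans (cong (λ x → sgn i * (x * det (minor A i zero))) (A₀≡0 i i≢p))
        (trans (cong (sgn i *_) (*-zeroˡ (det (minor A i zero)))) (*-zeroʳ (sgn i)))))

det-δ : ∀ {k} → det (δ {k}) ≡ + 1
det-δ {zero}  = refl
det-δ {suc k} =
  trans (det-row₀-sparse (δ {suc k}) zero (λ j j≢0 → δ-≢ (j≢0 ∘ sym))) (cong (λ d → + 1 * (+ 1 * d)) (det-δ {k}))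

_[_]≔_ : ∀ {k m} → Mat k m → Fin k → (Fin m → ℤ) → Mat k m
A [ p ]≔ x = updateAt A p (const x)

≔-here : ∀ {k m} (A : Mat k m) (p : Fin k) (x : Fin m → ℤ) j → (A [ p ]≔ x) p j ≡ x j
≔-here A p x j = cong-app (updateAt-updates p A) j

≔-there : ∀ {k m} (A : Mat k m) {p i : Fin k} (x : Fin m → ℤ) → i ≢ p → ∀ j → (A [ p ]≔ x) i j ≡ A i j
≔-there A {p} {i} x i≢p j = cong-app (updateAt-minimal i p A i≢p) j

≔-unique : ∀ {k m} {A B : Mat k m} {p : Fin k} {x : Fin m → ℤ} →
           (∀ j → x j ≡ B p j) → (∀ i → i ≢ p → ∀ j → A i j ≡ B i j) → ∀ i j → (A [ p ]≔ x) i j ≡ B i j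
≔-unique {A = A} {p = p} {x} x≡ A≡ i j with i ≟ p
... | yes refl = trans (≔-here A i x j) (x≡ j)
... | no  i≢p  = trans (≔-there A x i≢p j) (A≡ i i≢p j)

≔-self : ∀ {k m} (A : Mat k m) (p : Fin k) {x : Fin m → ℤ} → (∀ j → x j ≡ A p j) →
         ∀ i j → (A [ p ]≔ x) i j ≡ A i j
≔-self A p x≡ = ≔-unique x≡ (λ _ _ _ → refl)

≔-cong : ∀ {k m} (A : Mat k m) (p : Fin k) {x y : Fin m → ℤ} → (∀ j → x j ≡ y j) →
         ∀ i j → (A [ p ]≔ x) i j ≡ (A [ p ]≔ y) i j
≔-cong A p {y = y} x≡y = ≔-unique (λ j → trans (x≡y j) (sym (≔-here A p y j))) (λ i i≢p j → sym (≔-there A y i≢p j))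

minor-≔ : ∀ {k} (A : Mat (suc k) (suc k)) (p : Fin k) (x : Fin (suc k) → ℤ) (j : Fin (suc k)) →
          ∀ i l → minor (A [ suc p ]≔ x) zero j i l ≡ (minor A zero j [ p ]≔ (x ∘ punchIn j)) i l
minor-≔ A p x j i l = cong-app (map-updateAt {f = _∘ punchIn j} (λ _ → refl) (A ∘ suc) p i) l

det-linear-row : ∀ {k m} (A : Mat k k) (p : Fin k) (c : Fin m → ℤ) (R : Fin m → Fin k → ℤ) →
                 det (A [ p ]≔ (λ j → ∑ (λ t → c t * R t j))) ≡ ∑ (λ t → c t * det (A [ p ]≔ R t))
det-linear-row {suc k} A zero c R = begin
  ∑ (λ j → sgn j * (∑ (λ t → c t * R t j) * D j))
    ≡⟨ ∑-cong (λ j → cong (sgn j *_) (trans (*-distribʳ-∑ (D j) (λ t → c t * R t j))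
                                            (∑-cong (λ t → *-assoc (c t) (R t j) (D j))))) ⟩
  ∑ (λ j → sgn j * ∑ (λ t → c t * (R t j * D j)))
    ≡⟨ ∑-comm-* sgn c (λ j t → R t j * D j) ⟩
  ∑ (λ t → c t * ∑ (λ j → sgn j * (R t j * D j))) ∎
  where
  open ≡-Reasoning
  D : Fin (suc k) → ℤ
  D j = det (minor A zero j)
det-linear-row {suc k} {m} A (suc p) c R = begin
  ∑ (λ j → sgn j * (A zero j * det (minor (A [ suc p ]≔ X) zero j)))
    ≡⟨ ∑-cong (λ j → cong (λ d → sgn j * (A zero j * d))
                          (trans (det-cong (minor-≔ A p X j)) (det-linear-row (minor A zero j) p c (λ t → R t ∘ punchIn j)))) ⟩
  ∑ (λ j → sgn j * (A zero j * ∑ (λ t → c t * G j t)))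
    ≡⟨ ∑-cong (λ j → sym (*-assoc (sgn j) (A zero j) (∑ (λ t → c t * G j t)))) ⟩
  ∑ (λ j → sgn j * A zero j * ∑ (λ t → c t * G j t))
    ≡⟨ ∑-comm-* (λ j → sgn j * A zero j) c G ⟩
  ∑ (λ t → c t * ∑ (λ j → sgn j * A zero j * G j t))
    ≡⟨ ∑-cong (λ t → cong (c t *_) (∑-cong (λ j → trans (*-assoc (sgn j) (A zero j) (G j t))
         (cong (λ d → sgn j * (A zero j * d)) (sym (det-cong (minor-≔ A p (R t) j))))))) ⟩
  ∑ (λ t → c t * det (A [ suc p ]≔ R t)) ∎
  where
  open ≡-Reasoning
  X : Fin (suc k) → ℤ
  X j = ∑ (λ t → c t * R t j)
  G : Fin (suc k) → Fin m → ℤ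
  G j t = det (minor A zero j [ p ]≔ (R t ∘ punchIn j))

det-row-+ : ∀ {k} (A : Mat k k) (p : Fin k) (x y : Fin k → ℤ) →
            det (A [ p ]≔ (λ j → x j + y j)) ≡ det (A [ p ]≔ x) + det (A [ p ]≔ y)
det-row-+ {k} A p x y = begin
  det (A [ p ]≔ (λ j → x j + y j))
    ≡⟨ det-cong (≔-cong A p (λ j → as-sum (x j) (y j))) ⟩
  det (A [ p ]≔ (λ j → ∑ (λ t → + 1 * R t j)))
    ≡⟨ det-linear-row A p (λ _ → + 1) R ⟩
  + 1 * det (A [ p ]≔ x) + (+ 1 * det (A [ p ]≔ y) + + 0)
    ≡⟨ as-sum (det (A [ p ]≔ x)) (det (A [ p ]≔ y)) ⟨
  det (A [ p ]≔ x) + det (A [ p ]≔ y) ∎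
  where
  open ≡-Reasoning
  R : Fin 2 → Fin k → ℤ
  R = x ∷ y ∷ []
  as-sum : ∀ a b → a + b ≡ + 1 * a + (+ 1 * b + + 0)
  as-sum = solve-∀

det-zeroRow : ∀ {k} (A : Mat k k) (p : Fin k) → (∀ j → A p j ≡ + 0) → det A ≡ + 0
det-zeroRow A p Ap≡0 = trans (sym (det-cong (≔-self A p (sym ∘ Ap≡0)))) (det-linear-row {m = 0} A p (λ ()) (λ ()))

-- The determinant is alternating

-- The first two Laplace terms trade places; every other first-row minor has its first two
-- columns swapped.
det-swapCols₀₁ : ∀ {k} (A : Mat (suc (suc k)) (suc (suc k))) → det (λ i j → A i (swap₀₁ j)) ≡ - det A

∑-minors-swapCols₀₁ : ∀ {k} (A : Mat (suc (suc k)) (suc (suc k))) →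
  ∑ (λ j → sgn (suc (suc j)) * (A zero (suc (suc j)) * det (λ i l → A (suc i) (swap₀₁ (punchIn (suc (suc j)) l))))) ≡
  - ∑ (λ j → sgn (suc (suc j)) * (A zero (suc (suc j)) * det (minor A zero (suc (suc j)))))
∑-minors-swapCols₀₁ {zero}  A = refl
∑-minors-swapCols₀₁ {suc k} A = trans
  (∑-cong (λ j → trans (cong (λ d → sgn (suc (suc j)) * (A zero (suc (suc j)) * d))
                             (trans (det-cong (λ i l → cong (A (suc i)) (swap₀₁-punchIn₂₊ j l)))
                                    (det-swapCols₀₁ (minor A zero (suc (suc j))))))
                       (neg-inside (sgn (suc (suc j))) (A zero (suc (suc j))) (det (minor A zero (suc (suc j)))))))
  (∑-distrib-neg (λ j → sgn (suc (suc j)) * (A zero (suc (suc j)) * det (minor A zero (suc (suc j))))))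
  where
  neg-inside : ∀ s a d → s * (a * - d) ≡ - (s * (a * d))
  neg-inside = solve-∀

det-swapCols₀₁ A = begin
  + 1 * (A zero (suc zero) * det (λ i l → A (suc i) (swap₀₁ (suc l)))) +
    (- + 1 * (A zero zero * det (λ i l → A (suc i) (swap₀₁ (punchIn (suc zero) l)))) + S′)
    ≡⟨ cong₂ (λ d₁ d₀ → + 1 * (A zero (suc zero) * d₁) + (- + 1 * (A zero zero * d₀) + S′))
             (det-cong (λ i l → cong (A (suc i)) (swap₀₁-suc l)))
             (det-cong (λ i l → cong (A (suc i)) (swap₀₁-punchIn₁ l))) ⟩
  + 1 * (A zero (suc zero) * D₁) + (- + 1 * (A zero zero * D₀) + S′)
    ≡⟨ cong (λ s → + 1 * (A zero (suc zero) * D₁) + (- + 1 * (A zero zero * D₀) + s))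
            (∑-minors-swapCols₀₁ A) ⟩
  + 1 * (A zero (suc zero) * D₁) + (- + 1 * (A zero zero * D₀) + - S)
    ≡⟨ swap-terms (A zero (suc zero)) D₁ (A zero zero) D₀ S ⟩
  - det A ∎
  where
  open ≡-Reasoning
  D₀ D₁ S S′ : ℤ
  D₀ = det (minor A zero zero)
  D₁ = det (minor A zero (suc zero))
  S  = ∑ (λ j → sgn (suc (suc j)) * (A zero (suc (suc j)) * det (minor A zero (suc (suc j)))))
  S′ = ∑ (λ j → sgn (suc (suc j)) * (A zero (suc (suc j)) * det (λ i l → A (suc i) (swap₀₁ (punchIn (suc (suc j)) l)))))
  swap-terms : ∀ a₁ d₁ a₀ d₀ s →
               + 1 * (a₁ * d₁) + (- + 1 * (a₀ * d₀) + - s) ≡ - (+ 1 * (a₀ * d₀) + (- + 1 * (a₁ * d₁) + s))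
  swap-terms = solve-∀

det-swapRows₀₁ : ∀ {k} (A : Mat (suc (suc k)) (suc (suc k))) → det (λ i → A (swap₀₁ i)) ≡ - det A
det-swapRows₀₁ A = trans (sym (det-ᵀ (λ i → A (swap₀₁ i)))) (trans (det-swapCols₀₁ (A ᵀ)) (cong -_ (det-ᵀ A)))

DetAlternating : ℕ → Set
DetAlternating k = ∀ (A : Mat k k) {p q : Fin k} → p ≢ q → (∀ j → A p j ≡ A q j) → det A ≡ + 0

-- S x y puts x in row p and y in row q; expanding S (x + y) (x + y) = 0 by bilinearity
-- gives S x y = - S y x.
det-swapRows-if-alternating : ∀ {k} → DetAlternating k →
  ∀ (A : Mat k k) {p q : Fin k} → p ≢ q → det (λ i → A (transpose p q i)) ≡ - det A
det-swapRows-if-alternating {k} alternating A {p} {q} p≢q = begin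
  det (λ i → A (transpose p q i))  ≡⟨ det-cong swapped ⟨
  S (A q) (A p)                    ≡⟨ inverseʳ-unique (S (A p) (A q)) (S (A q) (A p)) (antisymmetric (A p) (A q)) ⟩
  - S (A p) (A q)                  ≡⟨ cong -_ (det-cong unchanged) ⟩
  - det A                          ∎
  where
  open ≡-Reasoning
  q≢p : q ≢ p
  q≢p = p≢q ∘ sym
  S : (Fin k → ℤ) → (Fin k → ℤ) → ℤ
  S x y = det ((A [ p ]≔ x) [ q ]≔ y)
  S-diagonal : ∀ z → S z z ≡ + 0
  S-diagonal z = alternating _ p≢q (λ j →
    trans (≔-there (A [ p ]≔ z) z p≢q j) (trans (≔-here A p z j) (sym (≔-here (A [ p ]≔ z) q z j))))
  commute : ∀ x y i j → ((A [ p ]≔ x) [ q ]≔ y) i j ≡ ((A [ q ]≔ y) [ p ]≔ x) i j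
  commute x y i j = cong-app (updateAt-commutes q p q≢p A i) j
  S-+ʳ : ∀ x y y′ → S x (λ j → y j + y′ j) ≡ S x y + S x y′
  S-+ʳ x = det-row-+ (A [ p ]≔ x) q
  S-+ˡ : ∀ x x′ y → S (λ j → x j + x′ j) y ≡ S x y + S x′ y
  S-+ˡ x x′ y = begin
    S (λ j → x j + x′ j) y
      ≡⟨ det-cong (commute (λ j → x j + x′ j) y) ⟩
    det ((A [ q ]≔ y) [ p ]≔ (λ j → x j + x′ j))
      ≡⟨ det-row-+ (A [ q ]≔ y) p x x′ ⟩
    det ((A [ q ]≔ y) [ p ]≔ x) + det ((A [ q ]≔ y) [ p ]≔ x′)
      ≡⟨ cong₂ _+_ (det-cong (commute x y)) (det-cong (commute x′ y)) ⟨
    S x y + S x′ y ∎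
  pad : ∀ a b → a + b ≡ (+ 0 + a) + (b + + 0)
  pad = solve-∀
  antisymmetric : ∀ x y → S x y + S y x ≡ + 0
  antisymmetric x y = begin
    S x y + S y x                       ≡⟨ pad (S x y) (S y x) ⟩
    (+ 0 + S x y) + (S y x + + 0)       ≡⟨ cong₂ (λ a b → (a + S x y) + (S y x + b)) (S-diagonal x) (S-diagonal y) ⟨
    (S x x + S x y) + (S y x + S y y)   ≡⟨ cong₂ _+_ (S-+ʳ x x y) (S-+ʳ y x y) ⟨
    S x x+y + S y x+y                   ≡⟨ S-+ˡ x y x+y ⟨
    S x+y x+y                           ≡⟨ S-diagonal x+y ⟩
    + 0                                 ∎
    where
    x+y : Fin k → ℤ
    x+y j = x j + y j
  unchanged : ∀ i j → ((A [ p ]≔ A p) [ q ]≔ A q) i j ≡ A i j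
  unchanged i j = trans (≔-self (A [ p ]≔ A p) q (λ j → sym (≔-there A (A p) q≢p j)) i j) (≔-self A p (λ _ → refl) i j)
  swapped : ∀ i j → ((A [ p ]≔ A q) [ q ]≔ A p) i j ≡ A (transpose p q i) j
  swapped = ≔-unique (λ j → cong (λ r → A r j) (sym (transpose-matchʳ p q))) (λ i i≢q j → by-cases i i≢q j (i ≟ p))
    where
    by-cases : ∀ i → i ≢ q → ∀ j → Dec (i ≡ p) → (A [ p ]≔ A q) i j ≡ A (transpose p q i) j
    by-cases i i≢q j (yes refl) = trans (≔-here A i (A q) j) (cong (λ r → A r j) (sym (transpose-matchˡ i q)))
    by-cases i i≢q j (no i≢p)   = trans (≔-there A (A q) i≢p j) (cong (λ r → A r j) (sym (transpose-other i≢p i≢q)))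

rows₀₁-equal : ∀ {k} (A : Mat (suc (suc k)) (suc (suc k))) → (∀ j → A zero j ≡ A (suc zero) j) → det A ≡ + 0
rows₀₁-equal A A₀≡A₁ = x≡-x⇒x≡0 (trans (sym (det-cong swap-invisible)) (det-swapRows₀₁ A))
  where
  swap-invisible : ∀ i j → A (swap₀₁ i) j ≡ A i j
  swap-invisible zero          j = sym (A₀≡A₁ j)
  swap-invisible (suc zero)    j = A₀≡A₁ j
  swap-invisible (suc (suc i)) j = refl

-- Swapping rows 1 and q + 2 inside every first-row minor negates det A and makes rows 0
-- and 1 equal.
row₀-equal : ∀ {k} → DetAlternating k →
             (A : Mat (suc k) (suc k)) (q : Fin k) → (∀ j → A zero j ≡ A (suc q) j) → det A ≡ + 0
row₀-equal {suc k} alternating A zero    A₀≡A₁ = rows₀₁-equal A A₀≡A₁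
row₀-equal {suc k} alternating A (suc q) A₀≡Aq = begin
  det A            ≡⟨ neg-involutive (det A) ⟨
  - - det A        ≡⟨ cong -_ A′≡-A ⟨
  - det A′         ≡⟨ cong -_ (rows₀₁-equal A′ A′₀≡A′₁) ⟩
  + 0              ∎
  where
  open ≡-Reasoning
  A′ : Mat (suc (suc k)) (suc (suc k))
  A′ i = A (lift 1 (transpose zero (suc q)) i)
  A′₀≡A′₁ : ∀ j → A′ zero j ≡ A′ (suc zero) j
  A′₀≡A′₁ j = trans (A₀≡Aq j) (cong (λ r → A (suc r) j) (sym (transpose-matchˡ zero (suc q))))
  A′≡-A : det A′ ≡ - det A
  A′≡-A = trans (∑-cong (λ j → trans (cong (λ d → sgn j * (A zero j * d))
                                           (det-swapRows-if-alternating alternating (minor A zero j) {zero} {suc q} (λ ())))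
                                     (neg-inside (sgn j) (A zero j) (det (minor A zero j)))))
                (∑-distrib-neg (λ j → sgn j * (A zero j * det (minor A zero j))))
    where
    neg-inside : ∀ s a d → s * (a * - d) ≡ - (s * (a * d))
    neg-inside = solve-∀

det-alternating : ∀ {k} → DetAlternating k
det-alternating {zero}  A {()}
det-alternating {suc k} A {zero}  {zero}  0≢0 _     = ⊥-elim (0≢0 refl)
det-alternating {suc k} A {zero}  {suc q} _   A₀≡Aq = row₀-equal det-alternating A q A₀≡Aq
det-alternating {suc k} A {suc p} {zero}  _   Ap≡A₀ = row₀-equal det-alternating A p (sym ∘ Ap≡A₀)
det-alternating {suc k} A {suc p} {suc q} p≢q Ap≡Aq = ∑-zero (λ j → trans
  (cong (λ d → sgn j * (A zero j * d)) (det-alternating (minor A zero j) (p≢q ∘ cong suc) (λ l → Ap≡Aq (punchIn j l))))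
  (trans (cong (sgn j *_) (*-zeroʳ (A zero j))) (*-zeroʳ (sgn j))))

det-swapRows : ∀ {k} (A : Mat k k) {p q : Fin k} → p ≢ q → det (λ i → A (transpose p q i)) ≡ - det A
det-swapRows = det-swapRows-if-alternating det-alternating

det-alternating-cols : ∀ {k} (A : Mat k k) {p q : Fin k} → p ≢ q → (∀ i → A i p ≡ A i q) → det A ≡ + 0
det-alternating-cols A p≢q Ap≡Aq = trans (sym (det-ᵀ A)) (det-alternating (A ᵀ) p≢q Ap≡Aq)

det-zeroCol : ∀ {k} (A : Mat k k) (q : Fin k) → (∀ i → A i q ≡ + 0) → det A ≡ + 0
det-zeroCol A q Aq≡0 = trans (sym (det-ᵀ A)) (det-zeroRow (A ᵀ) q Aq≡0)

∣det∣-transposeRows : ∀ {k} (A : Mat k k) (p q : Fin k) → ∣ det (λ i → A (transpose p q i)) ∣ ≡ ∣ det A ∣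
∣det∣-transposeRows A p q with p ≟ q
... | yes refl = cong ∣_∣ (det-cong (λ i j → cong (λ r → A r j) (transpose-same p i)))
... | no  p≢q  = trans (cong ∣_∣ (det-swapRows A p≢q)) (∣-i∣≡∣i∣ (det A))

∣det∣-transposeCols : ∀ {k} (A : Mat k k) (p q : Fin k) → ∣ det (λ i j → A i (transpose p q j)) ∣ ≡ ∣ det A ∣
∣det∣-transposeCols A p q = begin
  ∣ det (λ i j → A i (transpose p q j)) ∣  ≡⟨ cong ∣_∣ (det-ᵀ (λ i j → A i (transpose p q j))) ⟨
  ∣ det (λ i → (A ᵀ) (transpose p q i)) ∣    ≡⟨ ∣det∣-transposeRows (A ᵀ) p q ⟩
  ∣ det (A ᵀ) ∣                            ≡⟨ cong ∣_∣ (det-ᵀ A) ⟩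
  ∣ det A ∣                                ∎
  where open ≡-Reasoning

rowDependent⇒det≡0 : ∀ {k} (A : Mat k k) (w : Fin k → ℤ) {a : Fin k} → w a ≢ + 0 →
                     (∀ j → ∑ (λ b → w b * A b j) ≡ + 0) → det A ≡ + 0
rowDependent⇒det≡0 A w {a} wa≢0 wA≡0 = i≢0∧i*j≡0⇒j≡0 wa≢0 (begin
  w a * det A                                   ≡⟨ cong (w a *_) (det-cong (≔-self A a (λ _ → refl))) ⟨
  w a * det (A [ a ]≔ A a)                      ≡⟨ ∑-single (λ b → w b * det (A [ a ]≔ A b)) a other-rows-vanish ⟨
  ∑ (λ b → w b * det (A [ a ]≔ A b))            ≡⟨ det-linear-row A a w A ⟨
  det (A [ a ]≔ (λ j → ∑ (λ b → w b * A b j)))  ≡⟨ det-zeroRow _ a (λ j → trans (≔-here A a _ j) (wA≡0 j)) ⟩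
  + 0                                           ∎)
  where
  open ≡-Reasoning
  other-rows-vanish : ∀ b → b ≢ a → w b * det (A [ a ]≔ A b) ≡ + 0
  other-rows-vanish b b≢a = trans (cong (w b *_) (det-alternating _ (b≢a ∘ sym)
    (λ j → trans (≔-here A a (A b) j) (sym (≔-there A (A b) b≢a j))))) (*-zeroʳ (w b))

-- Multiplicativity

infixl 7 _*ₘ_

_*ₘ_ : ∀ {k m l} → Mat k m → Mat m l → Mat k l
(A *ₘ B) i j = ∑ (λ t → A i t * B t j)

∑Fun : ∀ {k m} → ((Fin k → Fin m) → ℤ) → ℤ
∑Fun {zero}  F = F (λ ())
∑Fun {suc k} F = ∑ (λ t → ∑Fun (λ f → F (t ∷ f)))

∏ : ∀ {k} → (Fin k → ℤ) → ℤ
∏ {zero}  x = + 1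
∏ {suc k} x = x zero * ∏ (x ∘ suc)

∑Fun-cong : ∀ {k m} {F G : (Fin k → Fin m) → ℤ} → (∀ f → F f ≡ G f) → ∑Fun F ≡ ∑Fun G
∑Fun-cong {zero}  F≗G = F≗G (λ ())
∑Fun-cong {suc k} F≗G = ∑-cong (λ t → ∑Fun-cong (λ f → F≗G (t ∷ f)))

*-distribˡ-∑Fun : ∀ {k m} (c : ℤ) (F : (Fin k → Fin m) → ℤ) → c * ∑Fun F ≡ ∑Fun (λ f → c * F f)
*-distribˡ-∑Fun {zero}  c F = refl
*-distribˡ-∑Fun {suc k} c F =
  trans (*-distribˡ-∑ c (λ t → ∑Fun (λ f → F (t ∷ f)))) (∑-cong (λ t → *-distribˡ-∑Fun c (λ f → F (t ∷ f))))

*-distribʳ-∑Fun : ∀ {k m} (c : ℤ) (F : (Fin k → Fin m) → ℤ) → ∑Fun F * c ≡ ∑Fun (λ f → F f * c)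
*-distribʳ-∑Fun {zero}  c F = refl
*-distribʳ-∑Fun {suc k} c F =
  trans (*-distribʳ-∑ c (λ t → ∑Fun (λ f → F (t ∷ f)))) (∑-cong (λ t → *-distribʳ-∑Fun c (λ f → F (t ∷ f))))

∑Fun-∑ : ∀ {k m l} (G : (Fin k → Fin m) → Fin l → ℤ) →
         ∑Fun (λ f → ∑ (G f)) ≡ ∑ (λ j → ∑Fun (λ f → G f j))
∑Fun-∑ {zero}  G = refl
∑Fun-∑ {suc k} G = trans (∑-cong (λ t → ∑Fun-∑ (λ f → G (t ∷ f)))) (∑-comm (λ t j → ∑Fun (λ f → G (t ∷ f) j)))

det-*ₘ-expand : ∀ {k m} (C : Mat k m) (R : Mat m k) →
                det (C *ₘ R) ≡ ∑Fun (λ f → ∏ (λ i → C i (f i)) * det (λ i → R (f i)))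
det-*ₘ-expand {zero}      C R = refl
det-*ₘ-expand {suc k} {m} C R = begin
  ∑ (λ j → sgn j * ((C *ₘ R) zero j * det (minor (C *ₘ R) zero j)))
    ≡⟨ ∑-cong (λ j → cong (λ d → sgn j * ((C *ₘ R) zero j * d))
                          (det-*ₘ-expand (C ∘ suc) (λ t l → R t (punchIn j l)))) ⟩
  ∑ (λ j → sgn j * ((C *ₘ R) zero j * ∑Fun (λ f → P f * D j f)))
    ≡⟨ ∑-cong expand-row₀ ⟩
  ∑ (λ j → ∑ (λ t → ∑Fun (λ f → T j t f)))
    ≡⟨ ∑-comm (λ j t → ∑Fun (λ f → T j t f)) ⟩
  ∑ (λ t → ∑ (λ j → ∑Fun (λ f → T j t f)))
    ≡⟨ ∑-cong (λ t → sym (∑Fun-∑ (λ f j → T j t f))) ⟩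
  ∑ (λ t → ∑Fun (λ f → ∑ (λ j → T j t f)))
    ≡⟨ ∑-cong (λ t → ∑Fun-cong (λ f → trans (∑-cong (λ j → regroup (C zero t) (P f) (sgn j) (R t j) (D j f)))
                                             (sym (*-distribˡ-∑ (C zero t * P f) (λ j → sgn j * (R t j * D j f)))))) ⟩
  ∑ (λ t → ∑Fun (λ f → (C zero t * P f) * ∑ (λ j → sgn j * (R t j * D j f)))) ∎
  where
  open ≡-Reasoning
  P : (Fin k → Fin m) → ℤ
  P f = ∏ (λ i → C (suc i) (f i))
  D : Fin (suc k) → (Fin k → Fin m) → ℤ
  D j f = det (λ i l → R (f i) (punchIn j l))
  T : Fin (suc k) → Fin m → (Fin k → Fin m) → ℤ
  T j t f = sgn j * (C zero t * R t j) * (P f * D j f)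
  regroup : ∀ c p s r d → s * (c * r) * (p * d) ≡ (c * p) * (s * (r * d))
  regroup = solve-∀
  expand-row₀ : ∀ j → sgn j * ((C *ₘ R) zero j * ∑Fun (λ f → P f * D j f)) ≡ ∑ (λ t → ∑Fun (λ f → T j t f))
  expand-row₀ j = begin
    sgn j * (∑ (λ t → C zero t * R t j) * S)
      ≡⟨ cong (sgn j *_) (*-distribʳ-∑ S (λ t → C zero t * R t j)) ⟩
    sgn j * ∑ (λ t → C zero t * R t j * S)
      ≡⟨ *-distribˡ-∑ (sgn j) (λ t → C zero t * R t j * S) ⟩
    ∑ (λ t → sgn j * (C zero t * R t j * S))
      ≡⟨ ∑-cong (λ t → trans (sym (*-assoc (sgn j) (C zero t * R t j) S))
                             (*-distribˡ-∑Fun (sgn j * (C zero t * R t j)) (λ f → P f * D j f))) ⟩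
    ∑ (λ t → ∑Fun (λ f → T j t f)) ∎
    where
    S : ℤ
    S = ∑Fun (λ f → P f * D j f)

-- det (R ∘ f) = c · det R with c independent of R; together with det-*ₘ-expand and R = δ
-- this yields multiplicativity.
RowReindexFactor : ∀ {k} → (Fin k → Fin k) → Set
RowReindexFactor {k} f = Σ ℤ λ c → ∀ (R : Mat k k) → det (λ i → R (f i)) ≡ c * det R

rowReindexFactor-collision : ∀ {k} {f : Fin k → Fin k} {a b : Fin k} → a ≢ b → f a ≡ f b → RowReindexFactor f
rowReindexFactor-collision {f = f} a≢b fa≡fb =
  + 0 , λ R → trans (det-alternating (λ i → R (f i)) a≢b (λ j → cong (λ r → R r j) fa≡fb)) (sym (*-zeroˡ (det R)))

rowReindexFactor-fixing-zero : ∀ {k} → (∀ (g : Fin k → Fin k) → RowReindexFactor g) →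
                               (f : Fin (suc k) → Fin (suc k)) → f zero ≡ zero → RowReindexFactor f
rowReindexFactor-fixing-zero {k} reindex f f0≡0 with any? (λ i → f (suc i) ≟ zero)
... | yes (i , fi≡0) = rowReindexFactor-collision {f = f} {zero} {suc i} (λ ()) (trans f0≡0 (sym fi≡0))
... | no  f≢0        = c , scaling
  where
  0≢f : ∀ i → zero ≢ f (suc i)
  0≢f i 0≡fi = f≢0 (i , sym 0≡fi)
  g : Fin k → Fin k
  g i = punchOut (0≢f i)
  c : ℤ
  c = proj₁ (reindex g)
  scaling : ∀ R → det (λ i → R (f i)) ≡ c * det R
  scaling R = begin
    ∑ (λ j → sgn j * (R (f zero) j * det (λ i l → R (f (suc i)) (punchIn j l))))
      ≡⟨ ∑-cong (λ j → cong₂ (λ x d → sgn j * (x * d)) (cong (λ r → R r j) f0≡0)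
           (trans (det-cong (λ i l → cong (λ r → R r (punchIn j l)) (sym (punchIn-punchOut (0≢f i)))))
                  (proj₂ (reindex g) (minor R zero j)))) ⟩
    ∑ (λ j → sgn j * (R zero j * (c * det (minor R zero j))))
      ≡⟨ ∑-cong (λ j → exchange (sgn j) (R zero j) c (det (minor R zero j))) ⟩
    ∑ (λ j → c * (sgn j * (R zero j * det (minor R zero j))))
      ≡⟨ *-distribˡ-∑ c (λ j → sgn j * (R zero j * det (minor R zero j))) ⟨
    c * det R ∎
    where
    open ≡-Reasoning
    exchange : ∀ s r c d → s * (r * (c * d)) ≡ c * (s * (r * d))
    exchange = solve-∀

rowReindexFactor : ∀ {k} (f : Fin k → Fin k) → RowReindexFactor f
rowReindexFactor {zero}  f = + 1 , λ R → refl
rowReindexFactor {suc k} f with any? (λ q → f q ≟ zero)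
... | no f≢0 =
  let (a , b , a<b , same) = pigeonhole (n<1+n k) (λ q → punchOut (0≢f q))
  in rowReindexFactor-collision {f = f} (<⇒≢ a<b) (punchOut-injective (0≢f a) (0≢f b) same)
  where
  0≢f : ∀ q → zero ≢ f q
  0≢f q 0≡fq = f≢0 (q , sym 0≡fq)
... | yes (zero  , f0≡0) = rowReindexFactor-fixing-zero rowReindexFactor f f0≡0
... | yes (suc q , fq≡0) = - c , scaling
  where
  f′ : Fin (suc k) → Fin (suc k)
  f′ i = f (transpose zero (suc q) i)
  factor′ : RowReindexFactor f′
  factor′ = rowReindexFactor-fixing-zero rowReindexFactor f′ (trans (cong f (transpose-matchˡ zero (suc q))) fq≡0)
  c : ℤ
  c = proj₁ factor′
  scaling : ∀ R → det (λ i → R (f i)) ≡ - c * det R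
  scaling R = begin
    det (λ i → R (f i))
      ≡⟨ det-cong (λ i j → cong (λ r → R (f r) j) (transpose-inverse zero (suc q) {i})) ⟨
    det (λ i → R (f′ (transpose (suc q) zero i)))
      ≡⟨ det-swapRows (λ i → R (f′ i)) {suc q} {zero} (λ ()) ⟩
    - det (λ i → R (f′ i))
      ≡⟨ cong -_ (proj₂ factor′ R) ⟩
    - (c * det R)
      ≡⟨ neg-distribˡ-* c (det R) ⟩
    - c * det R ∎
    where open ≡-Reasoning

det-*ₘ : ∀ {k} (A B : Mat k k) → det (A *ₘ B) ≡ det A * det B
det-*ₘ {k} A B = begin
  det (A *ₘ B)     ≡⟨ factor B ⟩
  K * det B        ≡⟨ cong (_* det B) K≡detA ⟩
  det A * det B    ∎
  where
  open ≡-Reasoning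
  weight : (Fin k → Fin k) → ℤ
  weight f = ∏ (λ i → A i (f i)) * proj₁ (rowReindexFactor f)
  K : ℤ
  K = ∑Fun weight
  factor : ∀ R → det (A *ₘ R) ≡ K * det R
  factor R = begin
    det (A *ₘ R)
      ≡⟨ det-*ₘ-expand A R ⟩
    ∑Fun (λ f → ∏ (λ i → A i (f i)) * det (λ i → R (f i)))
      ≡⟨ ∑Fun-cong (λ f → trans (cong (∏ (λ i → A i (f i)) *_) (proj₂ (rowReindexFactor f) R))
                              (sym (*-assoc (∏ (λ i → A i (f i))) (proj₁ (rowReindexFactor f)) (det R)))) ⟩
    ∑Fun (λ f → weight f * det R)
      ≡⟨ *-distribʳ-∑Fun (det R) weight ⟨
    K * det R ∎
  K≡detA : K ≡ det A
  K≡detA = begin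
    K                ≡⟨ *-identityʳ K ⟨
    K * + 1          ≡⟨ cong (K *_) (det-δ {k}) ⟨
    K * det (δ {k})  ≡⟨ factor δ ⟨
    det (A *ₘ δ)     ≡⟨ det-cong (λ i j → ∑-*-δ (A i) j) ⟩
    det A            ∎

-- Singular matrices have a nontrivial kernel

HasNontrivialKernel : ∀ {k} → Mat k k → Set
HasNontrivialKernel {k} N = Σ (Fin k → ℤ) λ v → (∃ λ b → v b ≢ + 0) × (∀ a → ∑ (λ b → N a b * v b) ≡ + 0)

module PivotElimination {k} (N : Mat (suc k) (suc k)) (j : Fin (suc k)) where

  p : ℤ
  p = N zero j

  -- Column l ≢ j of N *ₘ E is p · (column l) − N₀ₗ · (column j) and column j is kept, so
  -- row 0 of N *ₘ E is p · eⱼ.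
  E : Mat (suc k) (suc k)
  E m l = p * δ m l - N zero l * δ m j + δ l j * δ m j

  N′ : Mat (suc k) (suc k)
  N′ = N *ₘ E

  N′-entry : ∀ a l → N′ a l ≡ p * N a l - N zero l * N a j + δ l j * N a j
  N′-entry a l = begin
    ∑ (λ m → N a m * E m l)
      ≡⟨ ∑-cong (λ m → spread (N a m) p (δ m l) (N zero l) (δ m j) (δ l j)) ⟩
    ∑ (λ m → p * (N a m * δ m l) - N zero l * (N a m * δ m j) + δ l j * (N a m * δ m j))
      ≡⟨ trans (∑-distrib-+ (λ m → p * (N a m * δ m l) - N zero l * (N a m * δ m j)) (λ m → δ l j * (N a m * δ m j)))
               (cong (_+ ∑ (λ m → δ l j * (N a m * δ m j)))
                     (∑-distrib-- (λ m → p * (N a m * δ m l)) (λ m → N zero l * (N a m * δ m j)))) ⟩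
    ∑ (λ m → p * (N a m * δ m l)) - ∑ (λ m → N zero l * (N a m * δ m j)) + ∑ (λ m → δ l j * (N a m * δ m j))
      ≡⟨ sym (cong₂ _+_ (cong₂ _-_ (*-distribˡ-∑ p (λ m → N a m * δ m l))
                                   (*-distribˡ-∑ (N zero l) (λ m → N a m * δ m j)))
                        (*-distribˡ-∑ (δ l j) (λ m → N a m * δ m j))) ⟩
    p * ∑ (λ m → N a m * δ m l) - N zero l * ∑ (λ m → N a m * δ m j) + δ l j * ∑ (λ m → N a m * δ m j)
      ≡⟨ cong₂ _+_ (cong₂ (λ x y → p * x - N zero l * y) (∑-*-δ (N a) l) (∑-*-δ (N a) j))
                   (cong (δ l j *_) (∑-*-δ (N a) j)) ⟩
    p * N a l - N zero l * N a j + δ l j * N a j ∎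
    where
    open ≡-Reasoning
    spread : ∀ n p d c e f → n * (p * d - c * e + f * e) ≡ p * (n * d) - c * (n * e) + f * (n * e)
    spread = solve-∀

  N′-row₀ : ∀ l → l ≢ j → N′ zero l ≡ + 0
  N′-row₀ l l≢j = trans (N′-entry zero l)
    (trans (cong (λ d → p * N zero l - N zero l * p + d * p) (δ-≢ l≢j)) (cancel p (N zero l)))
    where
    cancel : ∀ p x → p * x - x * p + + 0 * p ≡ + 0
    cancel = solve-∀

  N′-pivot : N′ zero j ≡ p
  N′-pivot = trans (N′-entry zero j) (trans (cong (λ d → p * p - p * p + d * p) (δ-refl j)) (cancel p))
    where
    cancel : ∀ p → p * p - p * p + + 1 * p ≡ p
    cancel = solve-∀

  N′-punchIn : ∀ a b → N′ a (punchIn j b) ≡ p * N a (punchIn j b) - N zero (punchIn j b) * N a j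
  N′-punchIn a b = trans (N′-entry a (punchIn j b))
    (trans (cong (λ d → X + d * N a j) (δ-≢ (punchInᵢ≢i j b))) (drop X (N a j)))
    where
    X : ℤ
    X = p * N a (punchIn j b) - N zero (punchIn j b) * N a j
    drop : ∀ x y → x + + 0 * y ≡ x
    drop = solve-∀

  reduced : Mat k k
  reduced = minor N′ zero j

  det-N′ : det N′ ≡ sgn j * (p * det reduced)
  det-N′ = trans (det-row₀-sparse N′ j N′-row₀) (cong (λ x → sgn j * (x * det reduced)) N′-pivot)

  -- extend μ = E μ̃, where μ̃ is μ with a 0 inserted at position j.
  extend : (Fin k → ℤ) → Fin (suc k) → ℤ
  extend μ = insertAt (λ b → p * μ b) j (- ∑ (λ b → N zero (punchIn j b) * μ b))

  extend-kernel : ∀ μ → (∀ a → ∑ (λ b → reduced a b * μ b) ≡ + 0) → ∀ a → ∑ (λ l → N a l * extend μ l) ≡ + 0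
  extend-kernel μ μ-kernel a = trans (N·extend a) (by-row a)
    where
    open ≡-Reasoning
    S : ℤ
    S = ∑ (λ b → N zero (punchIn j b) * μ b)
    N·extend : ∀ a → ∑ (λ l → N a l * extend μ l) ≡ ∑ (λ b → N′ a (punchIn j b) * μ b)
    N·extend a = begin
      ∑ (λ l → N a l * extend μ l)
        ≡⟨ ∑-insertAt (N a) (λ b → p * μ b) j (- S) ⟩
      N a j * - S + ∑ (λ b → N a (punchIn j b) * (p * μ b))
        ≡⟨ cong (_+ ∑ (λ b → N a (punchIn j b) * (p * μ b))) (trans (sym (neg-distribʳ-* (N a j) S))
             (trans (cong -_ (*-distribˡ-∑ (N a j) (λ b → N zero (punchIn j b) * μ b)))
                    (sym (∑-distrib-neg (λ b → N a j * (N zero (punchIn j b) * μ b)))))) ⟩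
      ∑ (λ b → - (N a j * (N zero (punchIn j b) * μ b))) + ∑ (λ b → N a (punchIn j b) * (p * μ b))
        ≡⟨ ∑-distrib-+ (λ b → - (N a j * (N zero (punchIn j b) * μ b))) (λ b → N a (punchIn j b) * (p * μ b)) ⟨
      ∑ (λ b → - (N a j * (N zero (punchIn j b) * μ b)) + N a (punchIn j b) * (p * μ b))
        ≡⟨ ∑-cong (λ b → trans (collect (N a j) (N zero (punchIn j b)) (μ b) (N a (punchIn j b)) p)
                               (cong (_* μ b) (sym (N′-punchIn a b)))) ⟩
      ∑ (λ b → N′ a (punchIn j b) * μ b) ∎
      where
      collect : ∀ x y m z p → - (x * (y * m)) + z * (p * m) ≡ (p * z - y * x) * m
      collect = solve-∀
    by-row : ∀ a → ∑ (λ b → N′ a (punchIn j b) * μ b) ≡ + 0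
    by-row zero     = ∑-zero (λ b → trans (cong (_* μ b) (N′-row₀ (punchIn j b) (punchInᵢ≢i j b))) (*-zeroˡ (μ b)))
    by-row (suc a′) = μ-kernel a′

kernel-from-pivot₀ : ∀ {k} → (∀ (M : Mat k k) → det M ≡ + 0 → HasNontrivialKernel M) →
                     (N : Mat (suc k) (suc k)) {j : Fin (suc k)} → det N ≡ + 0 → N zero j ≢ + 0 → HasNontrivialKernel N
kernel-from-pivot₀ kernel N {j} detN≡0 p≢0 = extend-nontrivial (kernel reduced det-reduced≡0)
  where
  open PivotElimination N j
  det-reduced≡0 : det reduced ≡ + 0
  det-reduced≡0 = i≢0∧i*j≡0⇒j≡0 p≢0 (i≢0∧i*j≡0⇒j≡0 (sgn≢0 j) (begin
    sgn j * (p * det reduced)  ≡⟨ det-N′ ⟨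
    det (N *ₘ E)               ≡⟨ det-*ₘ N E ⟩
    det N * det E              ≡⟨ cong (_* det E) detN≡0 ⟩
    + 0 * det E                ≡⟨ *-zeroˡ (det E) ⟩
    + 0                        ∎))
    where open ≡-Reasoning
  extend-nontrivial : HasNontrivialKernel reduced → HasNontrivialKernel N
  extend-nontrivial (μ , (b , μb≢0) , μ-kernel) = extend μ , (punchIn j b , extend≢0) , extend-kernel μ μ-kernel
    where
    extend≢0 : extend μ (punchIn j b) ≢ + 0
    extend≢0 v≡0 = [ p≢0 , μb≢0 ]′ (i*j≡0⇒i≡0∨j≡0 p (trans (sym (insertAt-punchIn _ j _ b)) v≡0))

det≡0⇒nontrivialKernel : ∀ {k} (N : Mat k k) → det N ≡ + 0 → HasNontrivialKernel N
det≡0⇒nontrivialKernel {zero}  N ()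
det≡0⇒nontrivialKernel {suc k} N detN≡0 with any? (λ i → any? (λ j → ¬? (N i j ≟ℤ + 0)))
... | no N≡0 = δ zero , (zero , λ ()) , λ a → ∑-zero (λ b → trans (cong (_* δ zero b) (N-zero a b)) (*-zeroˡ (δ zero b)))
  where
  N-zero : ∀ a b → N a b ≡ + 0
  N-zero a b = decidable-stable (N a b ≟ℤ + 0) (λ Nab≢0 → N≡0 (a , b , Nab≢0))
... | yes (i , j , Nij≢0) = unswap (kernel-from-pivot₀ det≡0⇒nontrivialKernel N₁ detN₁≡0 N₁0j≢0)
  where
  N₁ : Mat (suc k) (suc k)
  N₁ a = N (transpose zero i a)
  detN₁≡0 : det N₁ ≡ + 0
  detN₁≡0 = ∣i∣≡0⇒i≡0 (trans (∣det∣-transposeRows N zero i) (cong ∣_∣ detN≡0))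
  N₁0j≢0 : N₁ zero j ≢ + 0
  N₁0j≢0 = Nij≢0 ∘ trans (cong (λ r → N r j) (sym (transpose-matchˡ zero i)))
  unswap : HasNontrivialKernel N₁ → HasNontrivialKernel N
  unswap (v , v≢0 , N₁v≡0) = v , v≢0 , λ a →
    trans (∑-cong (λ b → cong (λ r → N r b * v b) (sym (transpose-inverse zero i {a})))) (N₁v≡0 (transpose i zero a))

_◂_ : ∀ {k m} → (Fin k → ℤ) → (Fin k → Fin m → ℤ) → Mat k (suc m)
(x ◂ B) a = x a ∷ B a

det-◂-linear : ∀ {k} (c : ℤ) (x y : Fin (suc k) → ℤ) (B : Fin (suc k) → Fin k → ℤ) →
               det ((λ a → c * x a - y a) ◂ B) ≡ c * det (x ◂ B) - det (y ◂ B)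
det-◂-linear {k} c x y B = begin
  det ((λ a → c * x a - y a) ◂ B)
    ≡⟨ det-col₀-expand ((λ a → c * x a - y a) ◂ B) ⟩
  ∑ (λ a → sgn a * ((c * x a - y a) * D a))
    ≡⟨ ∑-cong (λ a → spread (sgn a) c (x a) (y a) (D a)) ⟩
  ∑ (λ a → c * (sgn a * (x a * D a)) - sgn a * (y a * D a))
    ≡⟨ ∑-distrib-- (λ a → c * (sgn a * (x a * D a))) (λ a → sgn a * (y a * D a)) ⟩
  ∑ (λ a → c * (sgn a * (x a * D a))) - ∑ (λ a → sgn a * (y a * D a))
    ≡⟨ cong₂ _-_ (trans (sym (*-distribˡ-∑ c (λ a → sgn a * (x a * D a)))) (cong (c *_) (sym (det-col₀-expand (x ◂ B)))))
                 (sym (det-col₀-expand (y ◂ B))) ⟩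
  c * det (x ◂ B) - det (y ◂ B) ∎
  where
  open ≡-Reasoning
  D : Fin (suc k) → ℤ
  D a = det (λ i l → B (punchIn a i) l)
  spread : ∀ s c x y d → s * ((c * x - y) * d) ≡ c * (s * (x * d)) - s * (y * d)
  spread = solve-∀

det-subtractFirstColumn : ∀ {k} (B : Mat (suc k) (suc k)) →
                          det ((λ a → B a zero) ◂ (λ a i → B a (suc i) - B a zero)) ≡ det B
det-subtractFirstColumn {k} B = begin
  det ((λ a → B a zero) ◂ (λ a i → B a (suc i) - B a zero))  ≡⟨ det-cong entries ⟨
  det (B *ₘ E)                                              ≡⟨ det-*ₘ B E ⟩
  det B * det E                                             ≡⟨ cong (det B *_) det-E ⟩
  det B * + 1                                               ≡⟨ *-identityʳ (det B) ⟩
  det B                                                     ∎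
  where
  open ≡-Reasoning
  E : Mat (suc k) (suc k)
  E = (λ t → δ t zero) ◂ (λ t i → δ t (suc i) - δ t zero)
  det-E : det E ≡ + 1
  det-E = trans (det-col₀-sparse E zero (λ t t≢0 → δ-≢ t≢0))
                (cong (λ d → + 1 * (+ 1 * d)) (trans (det-cong {k} (λ x y → +-identityʳ (δ x y))) (det-δ {k})))
  entries : ∀ a j → (B *ₘ E) a j ≡ ((λ a → B a zero) ◂ (λ a i → B a (suc i) - B a zero)) a j
  entries a zero    = ∑-*-δ (B a) zero
  entries a (suc i) = begin
    ∑ (λ t → B a t * (δ t (suc i) - δ t zero))
      ≡⟨ ∑-cong (λ t → distribute (B a t) (δ t (suc i)) (δ t zero)) ⟩
    ∑ (λ t → B a t * δ t (suc i) - B a t * δ t zero)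
      ≡⟨ ∑-distrib-- (λ t → B a t * δ t (suc i)) (λ t → B a t * δ t zero) ⟩
    ∑ (λ t → B a t * δ t (suc i)) - ∑ (λ t → B a t * δ t zero)
      ≡⟨ cong₂ _-_ (∑-*-δ (B a) (suc i)) (∑-*-δ (B a) zero) ⟩
    B a (suc i) - B a zero ∎
    where
    distribute : ∀ x y z → x * (y - z) ≡ x * y - x * z
    distribute = solve-∀

∣det∣-unitColumn : ∀ {k} (A : Mat (suc k) (suc k)) {a b : Fin (suc k)} → A a b ≡ + 1 → (∀ x → x ≢ a → A x b ≡ + 0) →
                   ∣ det A ∣ ≡ ∣ det (λ x y → A (punchIn a x) (transpose zero b (suc y))) ∣
∣det∣-unitColumn {k} A {a} {b} Aab≡1 Axb≡0 = begin
  ∣ det A ∣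
    ≡⟨ ∣det∣-transposeCols A zero b ⟨
  ∣ det A′ ∣
    ≡⟨ cong ∣_∣ (det-col₀-sparse A′ a (λ x x≢a → trans (cong (A x) b-first) (Axb≡0 x x≢a))) ⟩
  ∣ sgn a * (A′ a zero * det (minor A′ a zero)) ∣
    ≡⟨ ∣sgn*∣ a (A′ a zero * det (minor A′ a zero)) ⟩
  ∣ A′ a zero * det (minor A′ a zero) ∣
    ≡⟨ cong (λ x → ∣ x * det (minor A′ a zero) ∣) (trans (cong (A a) b-first) Aab≡1) ⟩
  ∣ + 1 * det (minor A′ a zero) ∣
    ≡⟨ cong ∣_∣ (*-identityˡ (det (minor A′ a zero))) ⟩
  ∣ det (minor A′ a zero) ∣ ∎
  where
  open ≡-Reasoning
  A′ : Mat (suc k) (suc k)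
  A′ x y = A x (transpose zero b y)
  b-first : transpose zero b zero ≡ b
  b-first = transpose-matchˡ zero b

∣det∣-unitRow : ∀ {k} (A : Mat (suc k) (suc k)) {a b : Fin (suc k)} → A a b ≡ + 1 → (∀ y → y ≢ b → A a y ≡ + 0) →
                ∣ det A ∣ ≡ ∣ det (λ x y → A (transpose zero a (suc x)) (punchIn b y)) ∣
∣det∣-unitRow A {a} {b} Aab≡1 Aay≡0 = trans (cong ∣_∣ (sym (det-ᵀ A)))
  (trans (∣det∣-unitColumn (A ᵀ) Aab≡1 Aay≡0) (cong ∣_∣ (det-ᵀ (λ x y → A (transpose zero a (suc x)) (punchIn b y)))))

-- Total unimodularity of the Lawrence matrix

inj₂-or-inj₁ : ∀ {k} {A B : Set} (g : Fin k → A ⊎ B) →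
               (∃₂ λ b y → g b ≡ inj₂ y) ⊎ (Σ (Fin k → A) λ g′ → ∀ b → g b ≡ inj₁ (g′ b))
inj₂-or-inj₁ {zero}  g = inj₂ ((λ ()) , (λ ()))
inj₂-or-inj₁ {suc k} g with g zero in g0≡ | inj₂-or-inj₁ (g ∘ suc)
... | inj₂ y | _                 = inj₁ (zero , y , g0≡)
... | inj₁ x | inj₁ (b , y , gb≡) = inj₁ (suc b , y , gb≡)
... | inj₁ x | inj₂ (g′ , g≡)    = inj₂ (x ∷ g′ , λ { zero → g0≡ ; (suc b) → g≡ b })

data Occurrences {k} (P : Fin k → Set) : Set where
  none   : (∀ x → ¬ P x) → Occurrences P
  unique : ∀ x → P x → (∀ y → y ≢ x → ¬ P y) → Occurrences P
  twice  : ∀ {x y} → x ≢ y → P x → P y → Occurrences P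

occurrences : ∀ {k} {P : Fin k → Set} → (∀ x → Dec (P x)) → Occurrences P
occurrences P? with any? P?
... | no ∄x = none (λ x Px → ∄x (x , Px))
... | yes (x , Px) with any? (λ y → ¬? (y ≟ x) ×-dec P? y)
...   | yes (y , y≢x , Py) = twice y≢x Py Px
...   | no ∄y             = unique x Px (λ y y≢x Py → ∄y (y , y≢x , Py))

lawrenceVertex-∑y : ∀ {r n} (M : Mat r n) (v : VertexIx n) → ∑ (λ e → lawrenceVertex M v (inj₂ e)) ≡ + 1
lawrenceVertex-∑y M (inj₁ e) = ∑-δ e
lawrenceVertex-∑y M (inj₂ e) = ∑-δ e

module LawrenceMinors {r n} (M : Mat r n) where

  lawrenceMinor : ∀ {k} → (Fin k → Coord r n) → (Fin k → VertexIx n) → Mat k k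
  lawrenceMinor f g a b = lawrenceVertex M (g b) (f a)

  _≟ᶜ_ : (c c′ : Coord r n) → Dec (c ≡ c′)
  _≟ᶜ_ = ≡-dec _≟_ _≟_

  UnimodularMinors : ℕ → Set
  UnimodularMinors k = ∀ (f : Fin k → Coord r n) (g : Fin k → VertexIx n) → ∣ det (lawrenceMinor f g) ∣ ℕ.≤ 1

  yColumn-entry : ∀ {k} (f : Fin k → Coord r n) (g : Fin k → VertexIx n) {x b e} →
                  g b ≡ inj₂ e → f x ≢ inj₂ e → lawrenceMinor f g x b ≡ + 0
  yColumn-entry f g {x} gb≡e fx≢e with f x
  ... | inj₁ i  rewrite gb≡e = refl
  ... | inj₂ e′ rewrite gb≡e = δ-≢ (fx≢e ∘ cong inj₂ ∘ sym)

  -- The column of a vertex (0, eₑ) vanishes except for a 1 in row yₑ; once every column is a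
  -- vertex (Mₑ′, eₑ′), the row yₑ is the indicator of the columns with e′ = e. Either way
  -- the minor has a zero line, two equal lines, or a unit line to expand along.
  minors-yVertex : ∀ {k} → UnimodularMinors k →
                   ∀ f g {b e} → g b ≡ inj₂ e → ∣ det (lawrenceMinor {suc k} f g) ∣ ℕ.≤ 1
  minors-yVertex minors f g {b} {e} gb≡e with occurrences (λ x → f x ≟ᶜ inj₂ e)
  ... | none f≢e =
    i≡0⇒∣i∣≤1 (det-zeroCol (lawrenceMinor f g) b (λ x → yColumn-entry f g gb≡e (f≢e x)))
  ... | twice x≢y fx≡e fy≡e =
    i≡0⇒∣i∣≤1 (det-alternating (lawrenceMinor f g) x≢y (λ j → cong (lawrenceVertex M (g j)) (trans fx≡e (sym fy≡e))))
  ... | unique a fa≡e others = subst (ℕ._≤ 1)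
    (sym (∣det∣-unitColumn (lawrenceMinor f g) (trans (cong₂ (lawrenceVertex M) gb≡e fa≡e) (δ-refl e))
                                               (λ x x≢a → yColumn-entry f g gb≡e (others x x≢a))))
    (minors (f ∘ punchIn a) (g ∘ transpose zero b ∘ suc))

  minors-yCoordinate : ∀ {k} → UnimodularMinors k → ∀ f g {a e} (g′ : Fin (suc k) → Fin n) →
                       (∀ y → g y ≡ inj₁ (g′ y)) → f a ≡ inj₂ e → ∣ det (lawrenceMinor {suc k} f g) ∣ ℕ.≤ 1
  minors-yCoordinate minors f g {a} {e} g′ g≡ fa≡e with occurrences (λ y → g′ y ≟ e)
  ... | none g′≢e =
    i≡0⇒∣i∣≤1 (det-zeroRow (lawrenceMinor f g) a
      (λ y → trans (cong₂ (lawrenceVertex M) (g≡ y) fa≡e) (δ-≢ (g′≢e y))))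
  ... | twice y≢y′ g′y≡e g′y′≡e =
    i≡0⇒∣i∣≤1 (det-alternating-cols (lawrenceMinor f g) y≢y′ (λ i → cong (λ v → lawrenceVertex M v (f i))
      (trans (g≡ _) (trans (cong inj₁ (trans g′y≡e (sym g′y′≡e))) (sym (g≡ _))))))
  ... | unique b g′b≡e others = subst (ℕ._≤ 1)
    (sym (∣det∣-unitRow (lawrenceMinor f g) (trans (row-entry b) (trans (cong (λ v → δ v e) g′b≡e) (δ-refl e)))
                          (λ y y≢b → trans (row-entry y) (δ-≢ (others y y≢b)))))
    (minors (f ∘ transpose zero a ∘ suc) (g ∘ punchIn b))
    where
    row-entry : ∀ y → lawrenceMinor f g a y ≡ δ (g′ y) e
    row-entry y = cong₂ (lawrenceVertex M) (g≡ y) fa≡e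

  lawrence-unimodular : TotallyUnimodular M → ∀ k → UnimodularMinors k
  lawrence-unimodular tu zero    f g = s≤s z≤n
  lawrence-unimodular tu (suc k) f g with inj₂-or-inj₁ g
  ... | inj₁ (b , e , gb≡e) = minors-yVertex (lawrence-unimodular tu k) f g gb≡e
  ... | inj₂ (g′ , g≡) with inj₂-or-inj₁ f
  ...   | inj₁ (a , e , fa≡e) = minors-yCoordinate (lawrence-unimodular tu k) f g g′ g≡ fa≡e
  ...   | inj₂ (f′ , f≡)     =
    subst (λ d → ∣ d ∣ ℕ.≤ 1) (sym (det-cong (λ i j → cong₂ (lawrenceVertex M) (g≡ j) (f≡ i))))
          (unit-or-zero (tu (suc k) f′ g′))
    where
    unit-or-zero : ∀ {d} → (d ≡ - (+ 1)) ⊎ (d ≡ + 0) ⊎ (d ≡ + 1) → ∣ d ∣ ℕ.≤ 1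
    unit-or-zero (inj₁ refl)        = s≤s z≤n
    unit-or-zero (inj₂ (inj₁ refl)) = z≤n
    unit-or-zero (inj₂ (inj₂ refl)) = s≤s z≤n

-- Volume of a maximal simplex

module MaximalSimplex {r n} (M : Mat (suc r) n) (σ : Fin (suc (r ℕ.+ n)) → VertexIx n) where

  coord : Fin (suc r ℕ.+ n) → Coord (suc r) n
  coord = splitAt (suc r)

  ∑-coord : ∀ (F : Coord (suc r) n → ℤ) → ∑ (λ a → F (coord a)) ≡ ∑Coord F
  ∑-coord F = trans (∑-split (suc r) n (F ∘ coord))
    (cong₂ _+_ (∑-cong (λ i → cong F (splitAt-↑ˡ (suc r) i n))) (∑-cong (λ e → cong F (splitAt-↑ʳ (suc r) n e))))

  _·_ : (Coord (suc r) n → ℤ) → (Coord (suc r) n → ℤ) → ℤ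
  x · y = ∑Coord (λ c → x c * y c)

  ν : Coord (suc r) n → ℤ
  ν (inj₁ _) = + 0
  ν (inj₂ _) = + 1

  ν-· : ∀ x → ν · x ≡ ∑ (λ e → x (inj₂ e))
  ν-· x = trans (cong₂ _+_ (∑-zero (λ i → *-zeroˡ (x (inj₁ i)))) (∑-cong (λ e → *-identityˡ (x (inj₂ e)))))
                (+-identityˡ (∑ (λ e → x (inj₂ e))))

  vertex : Fin (suc (r ℕ.+ n)) → Coord (suc r) n → ℤ
  vertex b = lawrenceVertex M (σ b)

  edge : Fin (r ℕ.+ n) → Coord (suc r) n → ℤ
  edge = edgeVec M σ

  ν-edge : ∀ i → ν · edge i ≡ + 0
  ν-edge i = begin
    ν · edge i
      ≡⟨ ν-· (edge i) ⟩
    ∑ (λ e → vertex (suc i) (inj₂ e) - vertex zero (inj₂ e))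
      ≡⟨ ∑-distrib-- (λ e → vertex (suc i) (inj₂ e)) (λ e → vertex zero (inj₂ e)) ⟩
    ∑ (λ e → vertex (suc i) (inj₂ e)) - ∑ (λ e → vertex zero (inj₂ e))
      ≡⟨ cong₂ _-_ (lawrenceVertex-∑y M (σ (suc i))) (lawrenceVertex-∑y M (σ zero)) ⟩
    + 1 - + 1
      ≡⟨⟩
    + 0 ∎
    where open ≡-Reasoning

  V : Mat (suc (r ℕ.+ n)) (suc (r ℕ.+ n))
  V a b = vertex b (coord a)

  W : Fin (suc (r ℕ.+ n)) → Fin (r ℕ.+ n) → ℤ
  W a i = edge i (coord a)

  A : Mat (suc (r ℕ.+ n)) (suc (r ℕ.+ n))
  A = (ν ∘ coord) ◂ W

  det-AᵀA : det (A ᵀ *ₘ A) ≡ + n * det (gram M σ)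
  det-AᵀA = begin
    det (A ᵀ *ₘ A)
      ≡⟨ det-row₀-sparse (A ᵀ *ₘ A) zero first-row ⟩
    + 1 * ((A ᵀ *ₘ A) zero zero * det (minor (A ᵀ *ₘ A) zero zero))
      ≡⟨ cong₂ (λ x d → + 1 * (x * d)) (trans (∑-coord (λ c → ν c * ν c)) (trans (ν-· ν) (∑-one n)))
                                      (det-cong (λ i j → ∑-coord (λ c → edge i c * edge j c))) ⟩
    + 1 * (+ n * det (gram M σ))
      ≡⟨ *-identityˡ (+ n * det (gram M σ)) ⟩
    + n * det (gram M σ) ∎
    where
    open ≡-Reasoning
    first-row : ∀ j → j ≢ zero → (A ᵀ *ₘ A) zero j ≡ + 0
    first-row zero    0≢0 = ⊥-elim (0≢0 refl)
    first-row (suc j) _   = trans (∑-coord (λ c → ν c * edge j c)) (ν-edge j)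

  det-A : Fin n → det A ≡ + n * det V
  det-A e = sym (i-j≡0⇒i≡j (+ n * det V) (det A) (begin
    + n * det V - det A                       ≡⟨ cong (λ d → + n * d - det A) (det-subtractFirstColumn V) ⟨
    + n * det ((λ a → V a zero) ◂ W) - det A  ≡⟨ det-◂-linear (+ n) (λ a → V a zero) (ν ∘ coord) W ⟨
    det (n·v₀-ν ◂ W)                          ≡⟨ rowDependent⇒det≡0 (n·v₀-ν ◂ W) (ν ∘ coord) ν≢0 annihilated ⟩
    + 0                                       ∎))
    where
    open ≡-Reasoning
    n·v₀-ν : Fin (suc (r ℕ.+ n)) → ℤ
    n·v₀-ν a = + n * V a zero - ν (coord a)
    ν≢0 : ν (coord (join (suc r) n (inj₂ e))) ≢ + 0
    ν≢0 eq with trans (cong ν (sym (splitAt-join (suc r) n (inj₂ e)))) eq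
    ... | ()
    annihilated : ∀ j → ∑ (λ a → ν (coord a) * (n·v₀-ν ◂ W) a j) ≡ + 0
    annihilated zero = begin
      ∑ (λ a → ν (coord a) * n·v₀-ν a)
        ≡⟨ ∑-coord (λ c → ν c * (+ n * vertex zero c - ν c)) ⟩
      ν · (λ c → + n * vertex zero c - ν c)
        ≡⟨ ν-· (λ c → + n * vertex zero c - ν c) ⟩
      ∑ (λ e → + n * vertex zero (inj₂ e) - + 1)
        ≡⟨ ∑-distrib-- (λ e → + n * vertex zero (inj₂ e)) (λ _ → + 1) ⟩
      ∑ (λ e → + n * vertex zero (inj₂ e)) - ∑ {n} (λ _ → + 1)
        ≡⟨ cong₂ _-_ (trans (sym (*-distribˡ-∑ (+ n) (λ e → vertex zero (inj₂ e))))
                            (cong (+ n *_) (lawrenceVertex-∑y M (σ zero))))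
                     (∑-one n) ⟩
      + n * + 1 - + n
        ≡⟨ cancel (+ n) ⟩
      + 0 ∎
      where
      cancel : ∀ m → m * + 1 - m ≡ + 0
      cancel = solve-∀
    annihilated (suc i) = trans (∑-coord (λ c → ν c * edge i c)) (ν-edge i)

  det-V≢0 : AffinelyIndependent M σ → det V ≢ + 0
  det-V≢0 affine detV≡0 = contradict (det≡0⇒nontrivialKernel V detV≡0)
    where
    contradict : ¬ HasNontrivialKernel V
    contradict (μ , (b , μb≢0) , Vμ≡0) = μb≢0 (affine μ ∑μ≡0 dependence b)
      where
      dependence : ∀ c → ∑ (λ i → μ i * vertex i c) ≡ + 0
      dependence c = trans
        (∑-cong (λ i → trans (*-comm (μ i) (vertex i c)) (cong (λ c′ → vertex i c′ * μ i) (sym (splitAt-join (suc r) n c)))))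
        (Vμ≡0 (join (suc r) n c))
      ∑μ≡0 : ∑ μ ≡ + 0
      ∑μ≡0 = begin
        ∑ μ
          ≡⟨ ∑-cong (λ i → trans (sym (*-identityʳ (μ i))) (cong (μ i *_) (sym (lawrenceVertex-∑y M (σ i))))) ⟩
        ∑ (λ i → μ i * ∑ (λ e → vertex i (inj₂ e)))
          ≡⟨ ∑-cong (λ i → *-distribˡ-∑ (μ i) (λ e → vertex i (inj₂ e))) ⟩
        ∑ (λ i → ∑ (λ e → μ i * vertex i (inj₂ e)))
          ≡⟨ ∑-comm (λ i e → μ i * vertex i (inj₂ e)) ⟩
        ∑ (λ e → ∑ (λ i → μ i * vertex i (inj₂ e)))
          ≡⟨ ∑-zero (λ e → dependence (inj₂ e)) ⟩
        + 0 ∎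
        where open ≡-Reasoning

  det-V² : TotallyUnimodular M → AffinelyIndependent M σ → det V * det V ≡ + 1
  det-V² tu affine = ∣x∣≤1∧x≢0⇒x*x≡1 (LawrenceMinors.lawrence-unimodular M tu _ coord σ) (det-V≢0 affine)

  det-gram : TotallyUnimodular M → AffinelyIndependent M σ → Fin n → det (gram M σ) ≡ + n
  det-gram tu affine e = *-cancelˡ-≡ (+ n) (det (gram M σ)) (+ n) {{nonZeroIndex e}} (begin
    + n * det (gram M σ)             ≡⟨ det-AᵀA ⟨
    det (A ᵀ *ₘ A)                   ≡⟨ det-*ₘ (A ᵀ) A ⟩
    det (A ᵀ) * det A                ≡⟨ cong (_* det A) (det-ᵀ A) ⟩
    det A * det A                    ≡⟨ cong₂ _*_ (det-A e) (det-A e) ⟩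
    + n * det V * (+ n * det V)      ≡⟨ regroup (+ n) (det V) ⟩
    + n * (+ n * (det V * det V))    ≡⟨ cong (λ x → + n * (+ n * x)) (det-V² tu affine) ⟩
    + n * (+ n * + 1)                ≡⟨ cong (+ n *_) (*-identityʳ (+ n)) ⟩
    + n * + n                        ∎)
    where
    open ≡-Reasoning
    regroup : ∀ m v → m * v * (m * v) ≡ m * (m * (v * v))
    regroup = solve-∀

det-gram-maximalSimplex : ∀ {r n d} (M : Mat (suc r) n) → TotallyUnimodular M → Fin n → d ≡ r ℕ.+ n →
                          (σ : Fin (suc d) → VertexIx n) → AffinelyIndependent M σ → det (gram M σ) ≡ + n
det-gram-maximalSimplex M tu e refl σ affine = MaximalSimplex.det-gram M σ tu affine e

dimP-suc : ∀ n r → dimP n (suc r) ≡ r ℕ.+ n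
dimP-suc n r = trans (cong (ℕ._∸ 1) (+-suc n r)) (ℕ+-comm n r)

lemma4p13 : (r n : ℕ) (M : Mat r n) → 0 < r → HasRank M r →
    TotallyUnimodular M → Loopless M →
    (σ : Fin (suc (dimP n r)) → VertexIx n) → IsMaximalSimplex M σ →
    volSq M σ ≡ _/_ (+ n) (dimP n r ! ℕ.* dimP n r !) {{dimP n r !* dimP n r !≢0}}
lemma4p13 (suc r) n M (s≤s z≤n) (_ , columns , _) tu _ σ (_ , affine) =
  cong (λ g → _/_ g (dimP n (suc r) ! ℕ.* dimP n (suc r) !) {{dimP n (suc r) !* dimP n (suc r) !≢0}})
       (det-gram-maximalSimplex M tu (columns zero) (dimP-suc n r) σ affine)
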